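{- Let $n=2k$ be a positive even integer and $a_1,\dots,a_n$ positive integers. For $1\le m\le n$ write $m=2l+r_0$ with $r_0\in\{0,1\}$, and for integers $i$ set $$\Gamma_n(m,i)=\sum_{j=0}^{\min\{m-1,\,2i-r_0\}}(-1)^j\,\gamma_n(m-1-j)\,\gamma_{2i-r_0}(j).$$ Then for every $1\le m\le n$, $$\gamma_n(m)=\sum_{i=r_0}^{\frac{n-m+r_0}{2}}a_{2i+1-r_0}\,\Gamma_n(m,i).$$
   Context: For an integer $s\ge 1$ and $1\le l\le s$, $I_{s,l}$ is the set of strictly increasing sequences $(t_1,\dots,t_l)$ in $\{1,\dots,s\}$ with $t_i\equiv s+i-l\pmod 2$ for all $i$, and $\gamma_s(l)=\sum_{(t_1,\dots,t_l)\in I_{s,l}}a_{t_1}\cdots a_{t_l}$; also $\gamma_s(0)=1$ for every integer $s\ge 0$. -}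

module Defs where

open import Data.Nat using (ℕ; zero; suc; _+_; _*_; _∸_; _⊓_; _%_)
open import Data.Nat.Properties using (_≟_)
open import Data.Bool using (Bool; true; false; _∧_)
open import Data.List using (List; []; _∷_; _++_; map; filter; foldr; _∷ʳ_)
open import Data.Integer as ℤ using (ℤ; +_)
open import Relation.Nullary.Decidable using (⌊_⌋)
open import Relation.Binary.PropositionalEquality using (_≡_)
open import Relation.Unary using (Pred)
open import Level using (0ℓ)

incSeqs : ℕ → ℕ → List (List ℕ)
incSeqs zero    zero    = [] ∷ []
incSeqs zero    (suc l) = []
incSeqs (suc s) zero    = [] ∷ []
incSeqs (suc s) (suc l) = incSeqs s (suc l) ++ map (λ t → t ∷ʳ suc s) (incSeqs s l)

-- parity condition t_i ≡ s + i - l (mod 2), i.e. t_i + l ≡ s + i (mod 2),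
-- checked for positions i = 1,2,… of the list
parityFrom : ℕ → ℕ → ℕ → List ℕ → Bool
parityFrom s l i []       = true
parityFrom s l i (t ∷ ts) = ⌊ ((t + l) % 2) ≟ ((s + i) % 2) ⌋ ∧ parityFrom s l (suc i) ts

I : ℕ → ℕ → List (List ℕ)
I s l = filter (λ ts → parityFrom s l 1 ts ≟B true) (incSeqs s l)
  where
  open import Data.Bool.Properties renaming (_≟_ to _≟B_)

prodA : (ℕ → ℤ) → List ℕ → ℤ
prodA a = foldr (λ t r → a t ℤ.* r) (+ 1)

sumℤ : List ℤ → ℤ
sumℤ = foldr ℤ._+_ (+ 0)

γ : (ℕ → ℤ) → ℕ → ℕ → ℤ
γ a s l = sumℤ (map (prodA a) (I s l))

sumTo : ℕ → (ℕ → ℤ) → ℤ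
sumTo zero    f = f 0
sumTo (suc b) f = sumTo b f ℤ.+ f (suc b)

sumFromTo : ℕ → ℕ → (ℕ → ℤ) → ℤ
sumFromTo lo hi f = go (suc hi ∸ lo)
  where
  go : ℕ → ℤ
  go zero    = + 0
  go (suc c) = go c ℤ.+ f (lo + c)

sign : ℕ → ℤ
sign zero          = + 1
sign (suc zero)    = ℤ.- (+ 1)
sign (suc (suc j)) = sign j

Γ : (ℕ → ℤ) → ℕ → ℕ → ℕ → ℕ → ℤ
Γ a n m r₀ i = sumTo ((m ∸ 1) ⊓ (2 * i ∸ r₀))
  (λ j → sign j ℤ.* (γ a n (m ∸ 1 ∸ j) ℤ.* γ a (2 * i ∸ r₀) j))

module Submission where

-- Let Gₛ(x) = Σₗ γₛ(l) xˡ. Splitting sequences by their last entry gives the continuant recurrence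
-- G_{s+2}(x) = Gₛ(x) + a_{s+2} x G_{s+1}(x), with G₋₁ = G₀ = 1, and Γₙ(m,i) is the coefficient of
-- x^{m-1} in Gₙ(x) G_p(−x) for p = 2i − r₀. By the recurrence in the second factor,
-- a_{p+1} x G_p(−x) = G_{p−1}(−x) − G_{p+1}(−x), so the sum over p ≡ n − m (mod 2) telescopes and the
-- right-hand side is the coefficient of xᵐ in Gₙ(x) (1 − G_{n−m+1}(−x)). It remains that
-- [x^{δ+1+2e}] G_{q+δ}(x) G_q(−x) = 0: for δ = 0 because G_q(x) G_q(−x) is even, for δ = 1 by induction on q
-- using the symmetry x ↦ −x at even degree, and for δ ≥ 2 by the recurrence in the first factor.

open import Defs
open import Data.Nat as ℕ using (ℕ; zero; suc; _∸_; _≤_; _<_; _⊓_; z≤n; s≤s)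
import Data.Nat.Properties as ℕP
import Data.Nat.DivMod as DivMod
open import Data.Nat.Tactic.RingSolver as ℕSolver using ()
open import Data.Integer as ℤ using (ℤ; +_; -[1+_])
import Data.Integer.Properties as ℤP
open import Data.Integer.Tactic.RingSolver using (solve-∀)
open import Relation.Binary.PropositionalEquality
open import Data.Sum using (inj₁; inj₂)

double-suc : ∀ e → 2 ℕ.* suc e ≡ suc (suc (2 ℕ.* e))
double-suc = ℕSolver.solve-∀

module AlternatingConvolution where
  open import Data.Integer using (_+_; _*_; -_; _-_)
  open ≡-Reasoning

  sumTo-cong : ∀ b {f g : ℕ → ℤ} → (∀ j → j ≤ b → f j ≡ g j) → sumTo b f ≡ sumTo b g
  sumTo-cong zero    f≡g = f≡g 0 z≤n
  sumTo-cong (suc b) f≡g =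
    cong₂ _+_ (sumTo-cong b (λ j j≤b → f≡g j (ℕP.m≤n⇒m≤1+n j≤b))) (f≡g (suc b) ℕP.≤-refl)

  sumTo-+ : ∀ b (f g : ℕ → ℤ) → sumTo b (λ j → f j + g j) ≡ sumTo b f + sumTo b g
  sumTo-+ zero    f g = refl
  sumTo-+ (suc b) f g = begin
    sumTo b (λ j → f j + g j) + (f (suc b) + g (suc b))
      ≡⟨ cong (_+ (f (suc b) + g (suc b))) (sumTo-+ b f g) ⟩
    (sumTo b f + sumTo b g) + (f (suc b) + g (suc b))
      ≡⟨ interchange (sumTo b f) (sumTo b g) (f (suc b)) (g (suc b)) ⟩
    (sumTo b f + f (suc b)) + (sumTo b g + g (suc b)) ∎
    where
    interchange : ∀ x y z w → (x + y) + (z + w) ≡ (x + z) + (y + w)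
    interchange = solve-∀

  sumTo-*ˡ : ∀ b c (f : ℕ → ℤ) → sumTo b (λ j → c * f j) ≡ c * sumTo b f
  sumTo-*ˡ zero    c f = refl
  sumTo-*ˡ (suc b) c f =
    trans (cong (_+ c * f (suc b)) (sumTo-*ˡ b c f)) (sym (ℤP.*-distribˡ-+ c (sumTo b f) (f (suc b))))

  sumTo-suc : ∀ b (f : ℕ → ℤ) → sumTo (suc b) f ≡ f 0 + sumTo b (λ j → f (suc j))
  sumTo-suc zero    f = refl
  sumTo-suc (suc b) f =
    trans (cong (_+ f (suc (suc b))) (sumTo-suc b f)) (ℤP.+-assoc (f 0) _ _)

  sumTo-reverse : ∀ b (f : ℕ → ℤ) → sumTo b f ≡ sumTo b (λ j → f (b ∸ j))
  sumTo-reverse zero    f = refl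
  sumTo-reverse (suc b) f = begin
    sumTo (suc b) f
      ≡⟨ sumTo-suc b f ⟩
    f 0 + sumTo b (λ j → f (suc j))
      ≡⟨ cong (_+_ (f 0)) (sumTo-reverse b (λ j → f (suc j))) ⟩
    f 0 + sumTo b (λ j → f (suc (b ∸ j)))
      ≡⟨ cong (_+_ (f 0)) (sumTo-cong b (λ j j≤b → cong f (sym (ℕP.+-∸-assoc 1 j≤b)))) ⟩
    f 0 + sumTo b (λ j → f (suc b ∸ j))
      ≡⟨ ℤP.+-comm (f 0) _ ⟩
    sumTo b (λ j → f (suc b ∸ j)) + f 0
      ≡⟨ cong (λ i → sumTo b (λ j → f (suc b ∸ j)) + f i) (sym (ℕP.n∸n≡0 b)) ⟩
    sumTo (suc b) (λ j → f (suc b ∸ j)) ∎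

  sumTo-telescope : ∀ b (h : ℕ → ℤ) → sumTo b (λ j → h j - h (suc j)) ≡ h 0 - h (suc b)
  sumTo-telescope zero    h = refl
  sumTo-telescope (suc b) h = begin
    sumTo b (λ j → h j - h (suc j)) + (h (suc b) - h (suc (suc b)))
      ≡⟨ cong (_+ (h (suc b) - h (suc (suc b)))) (sumTo-telescope b h) ⟩
    (h 0 - h (suc b)) + (h (suc b) - h (suc (suc b)))
      ≡⟨ cancel (h 0) (h (suc b)) (h (suc (suc b))) ⟩
    h 0 - h (suc (suc b)) ∎
    where
    cancel : ∀ x y z → (x - y) + (y - z) ≡ x - z
    cancel = solve-∀

  sumTo-extend : ∀ p c (f : ℕ → ℤ) → (∀ j → p < j → f j ≡ + 0) → sumTo (p ℕ.+ c) f ≡ sumTo p f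
  sumTo-extend p zero    f tail≡0 = cong (λ b → sumTo b f) (ℕP.+-identityʳ p)
  sumTo-extend p (suc c) f tail≡0 = begin
    sumTo (p ℕ.+ suc c) f                      ≡⟨ cong (λ b → sumTo b f) (ℕP.+-suc p c) ⟩
    sumTo (p ℕ.+ c) f + f (suc (p ℕ.+ c))      ≡⟨ cong₂ _+_ (sumTo-extend p c f tail≡0) (tail≡0 _ (s≤s (ℕP.m≤m+n p c))) ⟩
    sumTo p f + + 0                            ≡⟨ ℤP.+-identityʳ _ ⟩
    sumTo p f                                  ∎

  sumTo-⊓ : ∀ b p (f : ℕ → ℤ) → (∀ j → p < j → f j ≡ + 0) → sumTo (b ⊓ p) f ≡ sumTo b f
  sumTo-⊓ b p f tail≡0 with ℕP.≤-total b p
  ... | inj₁ b≤p = cong (λ c → sumTo c f) (ℕP.m≤n⇒m⊓n≡m b≤p)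
  ... | inj₂ p≤b = begin
    sumTo (b ⊓ p) f            ≡⟨ cong (λ c → sumTo c f) (ℕP.m≥n⇒m⊓n≡n p≤b) ⟩
    sumTo p f                  ≡⟨ sumTo-extend p (b ∸ p) f tail≡0 ⟨
    sumTo (p ℕ.+ (b ∸ p)) f    ≡⟨ cong (λ c → sumTo c f) (ℕP.m+[n∸m]≡n p≤b) ⟩
    sumTo b f                  ∎

  sign-suc : ∀ j → sign (suc j) ≡ - sign j
  sign-suc zero          = refl
  sign-suc (suc zero)    = refl
  sign-suc (suc (suc j)) = sign-suc j

  sign-∸ : ∀ L j → j ≤ L → sign (L ∸ j) ≡ sign L * sign j
  sign-∸ L       zero    _         = sym (ℤP.*-identityʳ (sign L))
  sign-∸ (suc L) (suc j) (s≤s j≤L) = begin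
    sign (L ∸ j)              ≡⟨ sign-∸ L j j≤L ⟩
    sign L * sign j           ≡⟨ neg-*-neg (sign L) (sign j) ⟩
    - sign L * - sign j       ≡⟨ cong₂ _*_ (sign-suc L) (sign-suc j) ⟨
    sign (suc L) * sign (suc j) ∎
    where
    neg-*-neg : ∀ x y → x * y ≡ - x * - y
    neg-*-neg = solve-∀

  sign-even : ∀ e → sign (2 ℕ.* e) ≡ + 1
  sign-even zero    = refl
  sign-even (suc e) = trans (cong sign (double-suc e)) (sign-even e)

  δ₀ : ℕ → ℤ
  δ₀ zero    = + 1
  δ₀ (suc _) = + 0

  shift : (ℕ → ℤ) → ℕ → ℤ
  shift f zero    = + 0
  shift f (suc l) = f l

  -- altConv c d is the coefficient sequence of c(x)·d(−x).
  altConv : (ℕ → ℤ) → (ℕ → ℤ) → ℕ → ℤ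
  altConv c d L = sumTo L (λ j → sign j * (c (L ∸ j) * d j))

  altConv-linearˡ : ∀ c d k e L →
    altConv (λ l → c l + k * d l) e L ≡ altConv c e L + k * altConv d e L
  altConv-linearˡ c d k e L = begin
    altConv (λ l → c l + k * d l) e L
      ≡⟨ sumTo-cong L (λ j _ → distrib (sign j) (c (L ∸ j)) k (d (L ∸ j)) (e j)) ⟩
    sumTo L (λ j → sign j * (c (L ∸ j) * e j) + k * (sign j * (d (L ∸ j) * e j)))
      ≡⟨ sumTo-+ L _ _ ⟩
    altConv c e L + sumTo L (λ j → k * (sign j * (d (L ∸ j) * e j)))
      ≡⟨ cong (_+_ (altConv c e L)) (sumTo-*ˡ L k _) ⟩
    altConv c e L + k * altConv d e L ∎
    where
    distrib : ∀ s x k y z → s * ((x + k * y) * z) ≡ s * (x * z) + k * (s * (y * z))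
    distrib = solve-∀

  altConv-linearʳ : ∀ e c d k L →
    altConv e (λ l → c l + k * d l) L ≡ altConv e c L + k * altConv e d L
  altConv-linearʳ e c d k L = begin
    altConv e (λ l → c l + k * d l) L
      ≡⟨ sumTo-cong L (λ j _ → distrib (sign j) (e (L ∸ j)) (c j) k (d j)) ⟩
    sumTo L (λ j → sign j * (e (L ∸ j) * c j) + k * (sign j * (e (L ∸ j) * d j)))
      ≡⟨ sumTo-+ L _ _ ⟩
    altConv e c L + sumTo L (λ j → k * (sign j * (e (L ∸ j) * d j)))
      ≡⟨ cong (_+_ (altConv e c L)) (sumTo-*ˡ L k _) ⟩
    altConv e c L + k * altConv e d L ∎
    where
    distrib : ∀ s z x k y → s * (z * (x + k * y)) ≡ s * (z * x) + k * (s * (z * y))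
    distrib = solve-∀

  altConv-shiftˡ : ∀ c d L → altConv (shift c) d (suc L) ≡ altConv c d L
  altConv-shiftˡ c d L = begin
    altConv (shift c) d (suc L)
      ≡⟨ cong₂ _+_ (sumTo-cong L (λ j j≤L → cong (λ i → sign j * (shift c i * d j)) (ℕP.+-∸-assoc 1 j≤L)))
                   (cong (λ i → sign (suc L) * (shift c i * d (suc L))) (ℕP.n∸n≡0 L)) ⟩
    altConv c d L + sign (suc L) * (+ 0 * d (suc L))
      ≡⟨ cong (_+_ (altConv c d L)) (trans (cong (sign (suc L) *_) (ℤP.*-zeroˡ (d (suc L)))) (ℤP.*-zeroʳ (sign (suc L)))) ⟩
    altConv c d L + + 0
      ≡⟨ ℤP.+-identityʳ _ ⟩
    altConv c d L ∎

  altConv-shiftʳ : ∀ c d L → altConv c (shift d) (suc L) ≡ - altConv c d L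
  altConv-shiftʳ c d L = begin
    altConv c (shift d) (suc L)
      ≡⟨ sumTo-suc L _ ⟩
    + 1 * (c (suc L) * + 0) + sumTo L (λ j → sign (suc j) * (c (L ∸ j) * d j))
      ≡⟨ cong₂ _+_ (trans (ℤP.*-identityˡ (c (suc L) * + 0)) (ℤP.*-zeroʳ (c (suc L)))) (sumTo-cong L (λ j _ → cong (_* (c (L ∸ j) * d j)) (sign-suc j))) ⟩
    + 0 + sumTo L (λ j → - sign j * (c (L ∸ j) * d j))
      ≡⟨ trans (ℤP.+-identityˡ _) (sumTo-cong L (λ j _ → neg-* (sign j) (c (L ∸ j) * d j))) ⟩
    sumTo L (λ j → - + 1 * (sign j * (c (L ∸ j) * d j)))
      ≡⟨ sumTo-*ˡ L (- + 1) _ ⟩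
    - + 1 * altConv c d L
      ≡⟨ ℤP.-1*i≡-i _ ⟩
    - altConv c d L ∎
    where
    neg-* : ∀ x y → - x * y ≡ - + 1 * (x * y)
    neg-* = solve-∀

  altConv-δ₀ʳ : ∀ c L → altConv c δ₀ L ≡ c L
  altConv-δ₀ʳ c L = begin
    altConv c δ₀ L
      ≡⟨ sumTo-⊓ L 0 _ (λ { (suc j) _ → trans (cong (sign (suc j) *_) (ℤP.*-zeroʳ (c (L ∸ suc j)))) (ℤP.*-zeroʳ (sign (suc j))) }) ⟨
    sumTo (L ⊓ 0) (λ j → sign j * (c (L ∸ j) * δ₀ j))
      ≡⟨ cong (λ b → sumTo b (λ j → sign j * (c (L ∸ j) * δ₀ j))) (ℕP.⊓-zeroʳ L) ⟩
    + 1 * (c L * + 1)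
      ≡⟨ trans (ℤP.*-identityˡ _) (ℤP.*-identityʳ _) ⟩
    c L ∎

  altConv-swap : ∀ c d L → altConv c d L ≡ sign L * altConv d c L
  altConv-swap c d L = begin
    altConv c d L
      ≡⟨ sumTo-reverse L _ ⟩
    sumTo L (λ j → sign (L ∸ j) * (c (L ∸ (L ∸ j)) * d (L ∸ j)))
      ≡⟨ sumTo-cong L reflect ⟩
    sumTo L (λ j → sign L * (sign j * (d (L ∸ j) * c j)))
      ≡⟨ sumTo-*ˡ L (sign L) _ ⟩
    sign L * altConv d c L ∎
    where
    reflect : ∀ j → j ≤ L →
      sign (L ∸ j) * (c (L ∸ (L ∸ j)) * d (L ∸ j)) ≡ sign L * (sign j * (d (L ∸ j) * c j))
    reflect j j≤L rewrite sign-∸ L j j≤L | ℕP.m∸[m∸n]≡n j≤L = rearrange (sign L) (sign j) (c j) (d (L ∸ j))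
      where
      rearrange : ∀ s t x y → (s * t) * (x * y) ≡ s * (t * (y * x))
      rearrange = solve-∀

  altConv-swap-even : ∀ c d e → altConv c d (2 ℕ.* e) ≡ altConv d c (2 ℕ.* e)
  altConv-swap-even c d e =
    trans (altConv-swap c d (2 ℕ.* e))
          (trans (cong (_* altConv d c (2 ℕ.* e)) (sign-even e)) (ℤP.*-identityˡ (altConv d c (2 ℕ.* e))))

  altConv-self-odd : ∀ c e → altConv c c (suc (2 ℕ.* e)) ≡ + 0
  altConv-self-odd c e = self-negating (begin
    altConv c c L               ≡⟨ altConv-swap c c L ⟩
    sign L * altConv c c L      ≡⟨ cong (_* altConv c c L) (trans (sign-suc (2 ℕ.* e)) (cong -_ (sign-even e))) ⟩
    - + 1 * altConv c c L       ≡⟨ ℤP.-1*i≡-i _ ⟩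
    - altConv c c L             ∎)
    where
    L = suc (2 ℕ.* e)
    self-negating : ∀ {x} → x ≡ - x → x ≡ + 0
    self-negating {+ zero}    _  = refl
    self-negating {+ (suc _)} ()
    self-negating { -[1+ _ ]} ()

module Continuants (a : ℕ → ℤ) where
  open import Data.Integer using (_+_; _*_; -_; _-_)
  open AlternatingConvolution
  open ≡-Reasoning

  -- K (suc s) is the coefficient sequence of Gₛ, and K 0 that of G₋₁ = 1.
  K : ℕ → ℕ → ℤ
  K zero                = δ₀
  K (suc zero)          = δ₀
  K (suc (suc s)) l     = K s l + a (suc s) * shift (K (suc s)) l

  K-constantTerm : ∀ s → K s 0 ≡ + 1
  K-constantTerm zero          = refl
  K-constantTerm (suc zero)    = refl
  K-constantTerm (suc (suc s)) = cong₂ _+_ (K-constantTerm s) (ℤP.*-zeroʳ (a (suc s)))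

  K-degree : ∀ s l → s < l → K (suc s) l ≡ + 0
  K-degree zero          (suc l)       _         = refl
  K-degree (suc zero)    (suc zero)    (s≤s ())
  K-degree (suc zero)    (suc (suc l)) _         = trans (ℤP.+-identityˡ _) (ℤP.*-zeroʳ (a 1))
  K-degree (suc (suc s)) (suc l)       (s≤s s<l) = begin
    K (suc s) (suc l) + a (suc (suc s)) * K (suc (suc s)) l
      ≡⟨ cong₂ (λ x y → x + a (suc (suc s)) * y) (K-degree s (suc l) (ℕP.m<n⇒m<1+n (ℕP.<-trans (ℕP.n<1+n s) s<l)))
                                                   (K-degree (suc s) l s<l) ⟩
    + 0 + a (suc (suc s)) * + 0
      ≡⟨ trans (ℤP.+-identityˡ _) (ℤP.*-zeroʳ (a (suc (suc s)))) ⟩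
    + 0 ∎

  Φ : ℕ → ℕ → ℕ → ℤ
  Φ s p = altConv (K s) (K p)

  Φ-stepˡ : ∀ s p L → Φ (suc (suc s)) p (suc L) ≡ Φ s p (suc L) + a (suc s) * Φ (suc s) p L
  Φ-stepˡ s p L = begin
    Φ (suc (suc s)) p (suc L)
      ≡⟨ altConv-linearˡ (K s) (shift (K (suc s))) (a (suc s)) (K p) (suc L) ⟩
    Φ s p (suc L) + a (suc s) * altConv (shift (K (suc s))) (K p) (suc L)
      ≡⟨ cong (λ x → Φ s p (suc L) + a (suc s) * x) (altConv-shiftˡ (K (suc s)) (K p) L) ⟩
    Φ s p (suc L) + a (suc s) * Φ (suc s) p L ∎

  Φ-stepʳ : ∀ s p L → Φ s (suc (suc p)) (suc L) ≡ Φ s p (suc L) - a (suc p) * Φ s (suc p) L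
  Φ-stepʳ s p L = begin
    Φ s (suc (suc p)) (suc L)
      ≡⟨ altConv-linearʳ (K s) (K p) (shift (K (suc p))) (a (suc p)) (suc L) ⟩
    Φ s p (suc L) + a (suc p) * altConv (K s) (shift (K (suc p))) (suc L)
      ≡⟨ cong (λ x → Φ s p (suc L) + a (suc p) * x) (altConv-shiftʳ (K s) (K (suc p)) L) ⟩
    Φ s p (suc L) + a (suc p) * - Φ s (suc p) L
      ≡⟨ cong (_+_ (Φ s p (suc L))) (sym (ℤP.neg-distribʳ-* (a (suc p)) (Φ s (suc p) L))) ⟩
    Φ s p (suc L) - a (suc p) * Φ s (suc p) L ∎

  Φ-initial : ∀ s r L → r ≤ 1 → Φ s r L ≡ K s L
  Φ-initial s zero    L _         = altConv-δ₀ʳ (K s) L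
  Φ-initial s (suc r) L (s≤s z≤n) = altConv-δ₀ʳ (K s) L

  Φ-vanishes-subdiagonal : ∀ q e → Φ (suc q) q (suc (suc (2 ℕ.* e))) ≡ + 0
  Φ-vanishes-subdiagonal zero    e = altConv-δ₀ʳ δ₀ (suc (suc (2 ℕ.* e)))
  Φ-vanishes-subdiagonal (suc q) e = begin
    Φ (suc (suc q)) (suc q) (suc (suc (2 ℕ.* e)))
      ≡⟨ Φ-stepˡ q (suc q) (suc (2 ℕ.* e)) ⟩
    Φ q (suc q) (suc (suc (2 ℕ.* e))) + a (suc q) * Φ (suc q) (suc q) (suc (2 ℕ.* e))
      ≡⟨ cong₂ (λ x y → x + a (suc q) * y) swapped (altConv-self-odd (K (suc q)) e) ⟩
    + 0 + a (suc q) * + 0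
      ≡⟨ trans (ℤP.+-identityˡ _) (ℤP.*-zeroʳ (a (suc q))) ⟩
    + 0 ∎
    where
    swapped : Φ q (suc q) (suc (suc (2 ℕ.* e))) ≡ + 0
    swapped = begin
      Φ q (suc q) (suc (suc (2 ℕ.* e)))     ≡⟨ cong (Φ q (suc q)) (double-suc e) ⟨
      Φ q (suc q) (2 ℕ.* suc e)             ≡⟨ altConv-swap-even (K q) (K (suc q)) (suc e) ⟩
      Φ (suc q) q (2 ℕ.* suc e)             ≡⟨ cong (Φ (suc q) q) (double-suc e) ⟩
      Φ (suc q) q (suc (suc (2 ℕ.* e)))     ≡⟨ Φ-vanishes-subdiagonal q e ⟩
      + 0                                   ∎

  Φ-vanishes : ∀ δ q e → Φ (δ ℕ.+ q) q (suc δ ℕ.+ 2 ℕ.* e) ≡ + 0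
  Φ-vanishes zero             q e = altConv-self-odd (K q) e
  Φ-vanishes (suc zero)       q e = Φ-vanishes-subdiagonal q e
  Φ-vanishes (suc (suc δ))    q e = begin
    Φ (suc (suc (δ ℕ.+ q))) q (suc (suc (suc δ) ℕ.+ 2 ℕ.* e))
      ≡⟨ Φ-stepˡ (δ ℕ.+ q) q (suc (suc δ) ℕ.+ 2 ℕ.* e) ⟩
    Φ (δ ℕ.+ q) q (suc (suc (suc δ) ℕ.+ 2 ℕ.* e)) + a (suc (δ ℕ.+ q)) * Φ (suc δ ℕ.+ q) q (suc (suc δ) ℕ.+ 2 ℕ.* e)
      ≡⟨ cong₂ (λ x y → x + a (suc (δ ℕ.+ q)) * y)
               (trans (cong (Φ (δ ℕ.+ q) q) (cong suc (shift-by-two δ e))) (Φ-vanishes δ q (suc e)))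
               (Φ-vanishes (suc δ) q e) ⟩
    + 0 + a (suc (δ ℕ.+ q)) * + 0
      ≡⟨ trans (ℤP.+-identityˡ _) (ℤP.*-zeroʳ (a (suc (δ ℕ.+ q)))) ⟩
    + 0 ∎
    where
    shift-by-two : ∀ δ e → suc (suc (δ ℕ.+ 2 ℕ.* e)) ≡ δ ℕ.+ 2 ℕ.* suc e
    shift-by-two = ℕSolver.solve-∀

  Φ-telescope : ∀ s L r e →
    sumTo e (λ c → a (suc (2 ℕ.* c ℕ.+ r)) * Φ s (suc (2 ℕ.* c ℕ.+ r)) L)
      ≡ Φ s r (suc L) - Φ s (2 ℕ.* suc e ℕ.+ r) (suc L)
  Φ-telescope s L r e =
    trans (sumTo-cong e (λ c _ → difference c)) (sumTo-telescope e (λ c → Φ s (2 ℕ.* c ℕ.+ r) (suc L)))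
    where
    difference : ∀ c → a (suc (2 ℕ.* c ℕ.+ r)) * Φ s (suc (2 ℕ.* c ℕ.+ r)) L
                         ≡ Φ s (2 ℕ.* c ℕ.+ r) (suc L) - Φ s (2 ℕ.* suc c ℕ.+ r) (suc L)
    difference c = begin
      z                 ≡⟨ subtract-twice y z ⟩
      y - (y - z)       ≡⟨ cong (_-_ y) (Φ-stepʳ s p L) ⟨
      y - Φ s (suc (suc p)) (suc L)
                        ≡⟨ cong (λ i → y - Φ s i (suc L)) (cong (ℕ._+ r) (double-suc c)) ⟨
      y - Φ s (2 ℕ.* suc c ℕ.+ r) (suc L) ∎
      where
      p = 2 ℕ.* c ℕ.+ r
      y = Φ s p (suc L)
      z = a (suc p) * Φ s (suc p) L
      subtract-twice : ∀ y z → z ≡ y - (y - z)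
      subtract-twice = solve-∀

  K-expansion : ∀ L e r → r ≤ 1 →
    let s = suc (suc (L ℕ.+ (2 ℕ.* e ℕ.+ r))) in
    K s (suc L) ≡ sumTo e (λ c → a (suc (2 ℕ.* c ℕ.+ r)) * Φ s (suc (2 ℕ.* c ℕ.+ r)) L)
  K-expansion L e r r≤1 = sym (begin
    sumTo e (λ c → a (suc (2 ℕ.* c ℕ.+ r)) * Φ s (suc (2 ℕ.* c ℕ.+ r)) L)
      ≡⟨ Φ-telescope s L r e ⟩
    Φ s r (suc L) - Φ s (2 ℕ.* suc e ℕ.+ r) (suc L)
      ≡⟨ cong₂ _-_ (Φ-initial s r (suc L) r≤1) top-vanishes ⟩
    K s (suc L) - + 0
      ≡⟨ ℤP.+-identityʳ (K s (suc L)) ⟩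
    K s (suc L) ∎)
    where
    s = suc (suc (L ℕ.+ (2 ℕ.* e ℕ.+ r)))
    top-vanishes : Φ s (2 ℕ.* suc e ℕ.+ r) (suc L) ≡ + 0
    top-vanishes = subst₂ (λ t M → Φ t (2 ℕ.* suc e ℕ.+ r) M ≡ + 0)
                     (degree-sum L e r) (cong suc (ℕP.+-identityʳ L)) (Φ-vanishes L (2 ℕ.* suc e ℕ.+ r) 0)
      where
      degree-sum : ∀ L e r → L ℕ.+ (2 ℕ.* suc e ℕ.+ r) ≡ suc (suc (L ℕ.+ (2 ℕ.* e ℕ.+ r)))
      degree-sum = ℕSolver.solve-∀

module Enumeration (a : ℕ → ℤ) where
  open import Data.Integer using (_+_; _*_)
  open import Data.Bool using (Bool; true; false; _∧_; if_then_else_)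
  import Data.Bool.Properties as BoolP
  open import Data.List using (List; []; _∷_; _++_; map; filter; _∷ʳ_; length)
  import Data.List.Properties as ListP
  open import Data.List.Relation.Unary.All as All using (All; []; _∷_)
  import Data.List.Relation.Unary.All.Properties as AllP
  open import Relation.Nullary.Decidable using (⌊_⌋)
  open import Function using (_∘_)
  open Continuants a using (K; K-constantTerm)
  open ≡-Reasoning

  sumℤ-++ : ∀ xs ys → sumℤ (xs ++ ys) ≡ sumℤ xs + sumℤ ys
  sumℤ-++ []       ys = sym (ℤP.+-identityˡ (sumℤ ys))
  sumℤ-++ (x ∷ xs) ys = trans (cong (_+_ x) (sumℤ-++ xs ys)) (sym (ℤP.+-assoc x (sumℤ xs) (sumℤ ys)))

  sumℤ-map-*ʳ : ∀ {A : Set} (f : A → ℤ) c xs → sumℤ (map (λ x → f x * c) xs) ≡ sumℤ (map f xs) * c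
  sumℤ-map-*ʳ f c []       = sym (ℤP.*-zeroˡ c)
  sumℤ-map-*ʳ f c (x ∷ xs) =
    trans (cong (_+_ (f x * c)) (sumℤ-map-*ʳ f c xs)) (sym (ℤP.*-distribʳ-+ c (f x) (sumℤ (map f xs))))

  sumℤ-map-zero : ∀ {A : Set} (xs : List A) → sumℤ (map (λ _ → + 0) xs) ≡ + 0
  sumℤ-map-zero []       = refl
  sumℤ-map-zero (x ∷ xs) = trans (ℤP.+-identityˡ _) (sumℤ-map-zero xs)

  sumℤ-map-filter : ∀ {A : Set} (b : A → Bool) (f : A → ℤ) xs →
    sumℤ (map f (filter (λ x → b x BoolP.≟ true) xs)) ≡ sumℤ (map (λ x → if b x then f x else + 0) xs)
  sumℤ-map-filter b f []       = refl
  sumℤ-map-filter b f (x ∷ xs) with b x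
  ... | true  = cong (_+_ (f x)) (sumℤ-map-filter b f xs)
  ... | false = trans (sumℤ-map-filter b f xs) (sym (ℤP.+-identityˡ _))

  prodA-∷ʳ : ∀ ts x → prodA a (ts ∷ʳ x) ≡ prodA a ts * a x
  prodA-∷ʳ []       x = trans (ℤP.*-identityʳ (a x)) (sym (ℤP.*-identityˡ (a x)))
  prodA-∷ʳ (t ∷ ts) x = trans (cong (a t *_) (prodA-∷ʳ ts x)) (sym (ℤP.*-assoc (a t) (prodA a ts) (a x)))

  incSeqs-length : ∀ s l → All (λ ts → length ts ≡ l) (incSeqs s l)
  incSeqs-length zero    zero    = refl ∷ []
  incSeqs-length zero    (suc l) = []
  incSeqs-length (suc s) zero    = refl ∷ []
  incSeqs-length (suc s) (suc l) =
    AllP.++⁺ (incSeqs-length s (suc l)) (AllP.map⁺ (All.map (λ {ts} → length-∷ʳ {ts}) (incSeqs-length s l)))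
    where
    length-∷ʳ : ∀ {ts} → length ts ≡ l → length (ts ∷ʳ suc s) ≡ suc l
    length-∷ʳ {ts} refl = trans (ListP.length-++ ts) (ℕP.+-comm (length ts) 1)

  parity-suc : ∀ x y → ⌊ (suc x ℕ.% 2) ℕ.≟ (suc y ℕ.% 2) ⌋ ≡ ⌊ (x ℕ.% 2) ℕ.≟ (y ℕ.% 2) ⌋
  parity-suc zero          zero          = refl
  parity-suc zero          (suc zero)    = refl
  parity-suc zero          (suc (suc y)) = parity-suc zero y
  parity-suc (suc zero)    zero          = refl
  parity-suc (suc zero)    (suc zero)    = refl
  parity-suc (suc zero)    (suc (suc y)) = parity-suc (suc zero) y
  parity-suc (suc (suc x)) y             = parity-suc x y

  parity-differs : ∀ x → ⌊ (x ℕ.% 2) ℕ.≟ (suc x ℕ.% 2) ⌋ ≡ false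
  parity-differs zero          = refl
  parity-differs (suc zero)    = refl
  parity-differs (suc (suc x)) = parity-differs x

  entryParityOk : ℕ → ℕ → ℕ → ℕ → Bool
  entryParityOk S L i t = ⌊ ((t ℕ.+ L) ℕ.% 2) ℕ.≟ ((S ℕ.+ i) ℕ.% 2) ⌋

  parityFrom-+2 : ∀ S L i ts → parityFrom (suc (suc S)) L i ts ≡ parityFrom S L i ts
  parityFrom-+2 S L i []       = refl
  parityFrom-+2 S L i (t ∷ ts) = cong (entryParityOk S L i t ∧_) (parityFrom-+2 S L (suc i) ts)

  parityFrom-suc : ∀ S L i ts → parityFrom (suc S) (suc L) i ts ≡ parityFrom S L i ts
  parityFrom-suc S L i []       = refl
  parityFrom-suc S L i (t ∷ ts) = cong₂ _∧_ head (parityFrom-suc S L (suc i) ts)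
    where
    head : entryParityOk (suc S) (suc L) i t ≡ entryParityOk S L i t
    head rewrite ℕP.+-suc t L = parity-suc (t ℕ.+ L) (S ℕ.+ i)

  parityFrom-∷ʳ : ∀ S L i ts x →
    parityFrom S L i (ts ∷ʳ x) ≡ parityFrom S L i ts ∧ entryParityOk S L (i ℕ.+ length ts) x
  parityFrom-∷ʳ S L i []       x rewrite ℕP.+-identityʳ i = BoolP.∧-identityʳ _
  parityFrom-∷ʳ S L i (t ∷ ts) x rewrite parityFrom-∷ʳ S L (suc i) ts x | ℕP.+-suc i (length ts) =
    sym (BoolP.∧-assoc (entryParityOk S L i t) _ _)

  parityFrom-∷ʳ-accept : ∀ S ts → parityFrom (suc S) (suc (length ts)) 1 (ts ∷ʳ suc S) ≡ parityFrom S (length ts) 1 ts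
  parityFrom-∷ʳ-accept S ts = begin
    parityFrom (suc S) (suc (length ts)) 1 (ts ∷ʳ suc S)
      ≡⟨ parityFrom-∷ʳ (suc S) (suc (length ts)) 1 ts (suc S) ⟩
    parityFrom (suc S) (suc (length ts)) 1 ts ∧ entryParityOk (suc S) (suc (length ts)) (suc (length ts)) (suc S)
      ≡⟨ cong₂ _∧_ (parityFrom-suc S (length ts) 1 ts) (cong ⌊_⌋ (ℕP.≟-diag refl)) ⟩
    parityFrom S (length ts) 1 ts ∧ true
      ≡⟨ BoolP.∧-identityʳ _ ⟩
    parityFrom S (length ts) 1 ts ∎

  parityFrom-∷ʳ-reject : ∀ S ts → parityFrom (suc (suc S)) (suc (length ts)) 1 (ts ∷ʳ suc S) ≡ false
  parityFrom-∷ʳ-reject S ts = begin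
    parityFrom (suc (suc S)) (suc (length ts)) 1 (ts ∷ʳ suc S)
      ≡⟨ parityFrom-∷ʳ (suc (suc S)) (suc (length ts)) 1 ts (suc S) ⟩
    parityFrom (suc (suc S)) (suc (length ts)) 1 ts ∧ entryParityOk (suc (suc S)) (suc (length ts)) (suc (length ts)) (suc S)
      ≡⟨ cong (parityFrom (suc (suc S)) (suc (length ts)) 1 ts ∧_) (parity-differs (suc S ℕ.+ suc (length ts))) ⟩
    parityFrom (suc (suc S)) (suc (length ts)) 1 ts ∧ false
      ≡⟨ BoolP.∧-zeroʳ _ ⟩
    false ∎

  weight : ℕ → ℕ → List ℕ → ℤ
  weight s l ts = if parityFrom s l 1 ts then prodA a ts else + 0

  weightSum : ℕ → ℕ → ℤ
  weightSum s l = sumℤ (map (weight s l) (incSeqs s l))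

  γ≡weightSum : ∀ s l → γ a s l ≡ weightSum s l
  γ≡weightSum s l = sumℤ-map-filter (parityFrom s l 1) (prodA a) (incSeqs s l)

  weight-+2 : ∀ S L ts → weight (suc (suc S)) L ts ≡ weight S L ts
  weight-+2 S L ts = cong (λ b → if b then prodA a ts else + 0) (parityFrom-+2 S L 1 ts)

  weight-∷ʳ-accept : ∀ S ts → weight (suc S) (suc (length ts)) (ts ∷ʳ suc S) ≡ weight S (length ts) ts * a (suc S)
  weight-∷ʳ-accept S ts rewrite parityFrom-∷ʳ-accept S ts | prodA-∷ʳ ts (suc S)
    with parityFrom S (length ts) 1 ts
  ... | true  = refl
  ... | false = sym (ℤP.*-zeroˡ (a (suc S)))

  weight-∷ʳ-reject : ∀ S ts → weight (suc (suc S)) (suc (length ts)) (ts ∷ʳ suc S) ≡ + 0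
  weight-∷ʳ-reject S ts rewrite parityFrom-∷ʳ-reject S ts = refl

  sumℤ-map-local : ∀ {A : Set} {f g : A → ℤ} {xs} → All (λ x → f x ≡ g x) xs → sumℤ (map f xs) ≡ sumℤ (map g xs)
  sumℤ-map-local = cong sumℤ ∘ ListP.map-cong-local

  weightSum-accept : ∀ S l xs → All (λ ts → length ts ≡ l) xs →
    sumℤ (map (weight (suc S) (suc l)) (map (_∷ʳ suc S) xs)) ≡ sumℤ (map (weight S l) xs) * a (suc S)
  weightSum-accept S l xs lengths = begin
    sumℤ (map (weight (suc S) (suc l)) (map (_∷ʳ suc S) xs))
      ≡⟨ cong sumℤ (ListP.map-∘ xs) ⟨
    sumℤ (map (λ ts → weight (suc S) (suc l) (ts ∷ʳ suc S)) xs)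
      ≡⟨ sumℤ-map-local (All.map (λ { {ts} refl → weight-∷ʳ-accept S ts }) lengths) ⟩
    sumℤ (map (λ ts → weight S l ts * a (suc S)) xs)
      ≡⟨ sumℤ-map-*ʳ (weight S l) (a (suc S)) xs ⟩
    sumℤ (map (weight S l) xs) * a (suc S) ∎

  weightSum-reject : ∀ S l xs → All (λ ts → length ts ≡ l) xs →
    sumℤ (map (weight (suc (suc S)) (suc l)) (map (_∷ʳ suc S) xs)) ≡ + 0
  weightSum-reject S l xs lengths = begin
    sumℤ (map (weight (suc (suc S)) (suc l)) (map (_∷ʳ suc S) xs))
      ≡⟨ cong sumℤ (ListP.map-∘ xs) ⟨
    sumℤ (map (λ ts → weight (suc (suc S)) (suc l) (ts ∷ʳ suc S)) xs)
      ≡⟨ sumℤ-map-local (All.map (λ { {ts} refl → weight-∷ʳ-reject S ts }) lengths) ⟩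
    sumℤ (map (λ _ → + 0) xs)
      ≡⟨ sumℤ-map-zero xs ⟩
    + 0 ∎

  -- A sequence in I_{s+2,l+1} ends in s+2, or in s+1 (never, by parity), or lies in I_{s,l+1}.
  weightSum≡K : ∀ s l → weightSum s l ≡ K (suc s) l
  weightSum≡K zero          zero    = refl
  weightSum≡K (suc s)       zero    = sym (K-constantTerm (suc (suc s)))
  weightSum≡K zero          (suc l) = refl
  weightSum≡K (suc zero)    (suc l) = begin
    weightSum 1 (suc l)      ≡⟨ weightSum-accept 0 l (incSeqs 0 l) (incSeqs-length 0 l) ⟩
    weightSum 0 l * a 1      ≡⟨ cong (_* a 1) (weightSum≡K 0 l) ⟩
    K 1 l * a 1              ≡⟨ trans (ℤP.*-comm (K 1 l) (a 1)) (sym (ℤP.+-identityˡ _)) ⟩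
    K 2 (suc l)              ∎
  weightSum≡K (suc (suc s)) (suc l) = begin
    weightSum (suc (suc s)) (suc l)
      ≡⟨ cong sumℤ (ListP.map-++ w (incSeqs s (suc l) ++ map (_∷ʳ suc s) (incSeqs s l)) _) ⟩
    sumℤ (map w (incSeqs s (suc l) ++ map (_∷ʳ suc s) (incSeqs s l)) ++ map w (map (_∷ʳ suc (suc s)) (incSeqs (suc s) l)))
      ≡⟨ sumℤ-++ (map w (incSeqs s (suc l) ++ map (_∷ʳ suc s) (incSeqs s l))) (map w (map (_∷ʳ suc (suc s)) (incSeqs (suc s) l))) ⟩
    sumℤ (map w (incSeqs s (suc l) ++ map (_∷ʳ suc s) (incSeqs s l))) + sumℤ (map w (map (_∷ʳ suc (suc s)) (incSeqs (suc s) l)))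
      ≡⟨ cong (_+ sumℤ (map w (map (_∷ʳ suc (suc s)) (incSeqs (suc s) l))))
              (trans (cong sumℤ (ListP.map-++ w (incSeqs s (suc l)) (map (_∷ʳ suc s) (incSeqs s l))))
                     (sumℤ-++ (map w (incSeqs s (suc l))) (map w (map (_∷ʳ suc s) (incSeqs s l))))) ⟩
    (sumℤ (map w (incSeqs s (suc l))) + sumℤ (map w (map (_∷ʳ suc s) (incSeqs s l))))
      + sumℤ (map w (map (_∷ʳ suc (suc s)) (incSeqs (suc s) l)))
      ≡⟨ cong₂ _+_ (cong₂ _+_ (cong sumℤ (ListP.map-cong (weight-+2 s (suc l)) (incSeqs s (suc l))))
                              (weightSum-reject s l (incSeqs s l) (incSeqs-length s l)))
                   (weightSum-accept (suc s) l (incSeqs (suc s) l) (incSeqs-length (suc s) l)) ⟩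
    (weightSum s (suc l) + + 0) + weightSum (suc s) l * a (suc (suc s))
      ≡⟨ cong₂ (λ x y → (x + + 0) + y * a (suc (suc s))) (weightSum≡K s (suc l)) (weightSum≡K (suc s) l) ⟩
    (K (suc s) (suc l) + + 0) + K (suc (suc s)) l * a (suc (suc s))
      ≡⟨ rearrange (K (suc s) (suc l)) (K (suc (suc s)) l) (a (suc (suc s))) ⟩
    K (suc (suc (suc s))) (suc l) ∎
    where
    w = weight (suc (suc s)) (suc l)
    rearrange : ∀ x y c → (x + + 0) + y * c ≡ x + c * y
    rearrange = solve-∀

  γ≡K : ∀ s l → γ a s l ≡ K (suc s) l
  γ≡K s l = trans (γ≡weightSum s l) (weightSum≡K s l)

module Expansion (a : ℕ → ℤ) where
  open import Data.Integer using (_+_; _*_)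
  open AlternatingConvolution
  open Continuants a
  open Enumeration a using (γ≡K)
  open ≡-Reasoning

  Γ≡Φ : ∀ n L r i → Γ a n (suc L) r i ≡ Φ (suc n) (suc (2 ℕ.* i ∸ r)) L
  Γ≡Φ n L r i = begin
    sumTo (L ⊓ q) (λ j → sign j * (γ a n (L ∸ j) * γ a q j))
      ≡⟨ sumTo-cong (L ⊓ q) (λ j _ → cong₂ (λ x y → sign j * (x * y)) (γ≡K n (L ∸ j)) (γ≡K q j)) ⟩
    sumTo (L ⊓ q) (λ j → sign j * (K (suc n) (L ∸ j) * K (suc q) j))
      ≡⟨ sumTo-⊓ L q _ beyond-degree ⟩
    Φ (suc n) (suc q) L ∎
    where
    q = 2 ℕ.* i ∸ r
    beyond-degree : ∀ j → q < j → sign j * (K (suc n) (L ∸ j) * K (suc q) j) ≡ + 0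
    beyond-degree j q<j = begin
      sign j * (K (suc n) (L ∸ j) * K (suc q) j)  ≡⟨ cong (λ y → sign j * (K (suc n) (L ∸ j) * y)) (K-degree q j q<j) ⟩
      sign j * (K (suc n) (L ∸ j) * + 0)          ≡⟨ cong (sign j *_) (ℤP.*-zeroʳ (K (suc n) (L ∸ j))) ⟩
      sign j * + 0                                ≡⟨ ℤP.*-zeroʳ (sign j) ⟩
      + 0                                         ∎

  sumFromTo-sumTo : ∀ r e (f : ℕ → ℤ) → r ≤ 1 → sumFromTo r (e ℕ.+ r) f ≡ sumTo e (λ c → f (c ℕ.+ r))
  sumFromTo-sumTo _ zero    f z≤n       = ℤP.+-identityˡ (f 0)
  sumFromTo-sumTo _ (suc e) f z≤n       = cong (_+ f (suc (e ℕ.+ 0))) (sumFromTo-sumTo 0 e f z≤n)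
  sumFromTo-sumTo _ zero    f (s≤s z≤n) = ℤP.+-identityˡ (f 1)
  sumFromTo-sumTo _ (suc e) f (s≤s z≤n) = cong (_+ f (suc (e ℕ.+ 1))) (sumFromTo-sumTo 1 e f (s≤s z≤n))

  γ-expansion : ∀ m e r → 1 ≤ m → r ≤ 1 →
    let n = m ℕ.+ (2 ℕ.* e ℕ.+ r) in
    γ a n m ≡ sumFromTo r (e ℕ.+ r) (λ i → a (2 ℕ.* i ℕ.+ 1 ∸ r) * Γ a n m r i)
  γ-expansion (suc L) e r (s≤s z≤n) r≤1 = begin
    γ a n (suc L)
      ≡⟨ γ≡K n (suc L) ⟩
    K (suc n) (suc L)
      ≡⟨ K-expansion L e r r≤1 ⟩
    sumTo e (λ c → a (suc (2 ℕ.* c ℕ.+ r)) * Φ (suc n) (suc (2 ℕ.* c ℕ.+ r)) L)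
      ≡⟨ sumTo-cong e (λ c _ → sym (term c)) ⟩
    sumTo e (λ c → f (c ℕ.+ r))
      ≡⟨ sumFromTo-sumTo r e f r≤1 ⟨
    sumFromTo r (e ℕ.+ r) f ∎
    where
    n = suc L ℕ.+ (2 ℕ.* e ℕ.+ r)
    f : ℕ → ℤ
    f i = a (2 ℕ.* i ℕ.+ 1 ∸ r) * Γ a n (suc L) r i
    double-+ : ∀ c r → 2 ℕ.* (c ℕ.+ r) ≡ 2 ℕ.* c ℕ.+ r ℕ.+ r
    double-+ = ℕSolver.solve-∀
    double-+-suc : ∀ c r → 2 ℕ.* (c ℕ.+ r) ℕ.+ 1 ≡ suc (2 ℕ.* c ℕ.+ r) ℕ.+ r
    double-+-suc = ℕSolver.solve-∀
    term : ∀ c → f (c ℕ.+ r) ≡ a (suc (2 ℕ.* c ℕ.+ r)) * Φ (suc n) (suc (2 ℕ.* c ℕ.+ r)) L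
    term c = cong₂ _*_
      (cong a (trans (cong (_∸ r) (double-+-suc c r)) (ℕP.m+n∸n≡m (suc (2 ℕ.* c ℕ.+ r)) r)))
      (trans (Γ≡Φ n L r (c ℕ.+ r))
             (cong (λ q → Φ (suc n) (suc q) L) (trans (cong (_∸ r) (double-+ c r)) (ℕP.m+n∸n≡m (2 ℕ.* c ℕ.+ r) r))))

open import Data.Nat using (_+_; _*_; _/_)
open import Data.Product using (_,_)

2l+r≤2k⇒l+r≤k : ∀ l r k → r ≤ 1 → 2 * l + r ≤ 2 * k → l + r ≤ k
2l+r≤2k⇒l+r≤k l _ k z≤n       m≤n =
  subst (_≤ k) (sym (ℕP.+-identityʳ l)) (ℕP.*-cancelˡ-≤ 2 (subst (_≤ 2 * k) (ℕP.+-identityʳ (2 * l)) m≤n))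
2l+r≤2k⇒l+r≤k l _ k (s≤s z≤n) m≤n =
  subst (_≤ k) (ℕP.+-comm 1 l) (ℕP.*-cancelˡ-< 2 l k (subst (_≤ 2 * k) (ℕP.+-comm (2 * l) 1) m≤n))

2[l+r+e]≡[2l+r]+[2e+r] : ∀ l r e → 2 * (l + r + e) ≡ (2 * l + r) + (2 * e + r)
2[l+r+e]≡[2l+r]+[2e+r] = ℕSolver.solve-∀

[2e+r+r]/2≡e+r : ∀ e r → (2 * e + r + r) / 2 ≡ e + r
[2e+r+r]/2≡e+r e r = trans (cong (_/ 2) (double e r)) (DivMod.m*n/n≡m (e + r) 2)
  where
  double : ∀ e r → 2 * e + r + r ≡ (e + r) * 2
  double = ℕSolver.solve-∀

lemma3 : (k : ℕ) → 1 ≤ 2 * k → (a : ℕ → ℕ) → (∀ t → 1 ≤ t → t ≤ 2 * k → 1 ≤ a t) →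
    (l r₀ : ℕ) → r₀ ≤ 1 → 1 ≤ 2 * l + r₀ → 2 * l + r₀ ≤ 2 * k →
    γ (λ t → + a t) (2 * k) (2 * l + r₀)
      ≡ sumFromTo r₀ ((2 * k ∸ (2 * l + r₀) + r₀) Data.Nat./ 2)
          (λ i → + a (2 * i + 1 ∸ r₀) ℤ.* Γ (λ t → + a t) (2 * k) (2 * l + r₀) r₀ i)
lemma3 k _ a _ l r r≤1 1≤m m≤n with ℕP.m≤n⇒∃[o]m+o≡n (2l+r≤2k⇒l+r≤k l r k r≤1 m≤n)
... | e , refl
  rewrite 2[l+r+e]≡[2l+r]+[2e+r] l r e | ℕP.m+n∸m≡n (2 * l + r) (2 * e + r) | [2e+r+r]/2≡e+r e r
  = Expansion.γ-expansion (λ t → + a t) (2 * l + r) e r 1≤m r≤1
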